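{- Let $A$ be an infinite set and $I$ a set, and let $\mathcal{B}$ be a subalgebra of the direct power $\Omega(A)^{I}$. Then there is a filter $F$ on the partition lattice $\Pi(I)$ such that for every function $f:I\rightarrow A$, we have $f\in\mathcal{B}$ if and only if $\Pi(f)\in F$.
   Context: For an infinite set $A$, let $\mathcal{F}$ be the type consisting of a constant symbol $\hat{a}$ for each $a\in A$ and an $n$-ary function symbol $\hat{f}$ for each function $f:A^{n}\rightarrow A$ with $n\geq 1$. $\Omega(A)$ is the algebra of type $\mathcal{F}$ with universe $A$ in which $\hat{a}$ is interpreted as $a$ and $\hat{f}$ as $f$. $\Pi(I)$ denotes the lattice of all partitions of $I$, ordered by refinement ($P\preceq Q$ means $P$ refines $Q$); a filter on $\Pi(I)$ is a nonempty subset closed under meets (common refinements) and under passing to coarser partitions. For $f:I\rightarrow A$, $\Pi(f)$ is the partition $\{f^{ -1}(\{x\})\mid x\in A\}\setminus\{\emptyset\}$ of $I$. -}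

module Defs where

open import Level using (0ℓ)
open import Data.Nat using (ℕ; suc)
open import Data.Fin using (Fin)
open import Data.Product using (Σ; ∃; _×_; _,_; proj₁)
open import Relation.Nullary using (¬_)
open import Relation.Binary.PropositionalEquality using (_≡_)
open import Relation.Binary.Core using (Rel)
open import Relation.Binary.Structures using (IsEquivalence)
open import Function.Bundles using (_↔_)

Infinite : Set → Set
Infinite A = (n : ℕ) → ¬ (A ↔ Fin n)

-- A subset B of the direct power Ω(A)^I is a subalgebra: it contains
-- the interpretation of every constant symbol â (the constant function
-- i ↦ a) and is closed under the pointwise interpretation of every
-- n-ary operation f : Aⁿ → A with n ≥ 1 (Aⁿ rendered as Fin n → A).
record IsSubalgebra (A I : Set) (B : (I → A) → Set) : Set where
  field
    const-closed : (a : A) → B (λ _ → a)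
    op-closed    : (n : ℕ) (f : (Fin (suc n) → A) → A)
                   (gs : Fin (suc n) → I → A) →
                   ((k : Fin (suc n)) → B (gs k)) →
                   B (λ i → f (λ k → gs k i))

-- Partitions of I, represented (canonically) by their equivalence
-- relations: i and j are related iff they lie in the same block.
Partition : Set → Set₁
Partition I = Σ (Rel I 0ℓ) IsEquivalence

_⪯_ : {I : Set} → Partition I → Partition I → Set
_⪯_ {I} P Q = ∀ {i j : I} → proj₁ P i j → proj₁ Q i j

_⊓_ : {I : Set} → Partition I → Partition I → Partition I
_⊓_ {I} (R , eR) (S , eS) = (λ i j → R i j × S i j) , record
  { refl  = IsEquivalence.refl eR , IsEquivalence.refl eS
  ; sym   = λ { (r , s) → IsEquivalence.sym eR r , IsEquivalence.sym eS s }
  ; trans = λ { (r , s) (r' , s') → IsEquivalence.trans eR r r'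
                                  , IsEquivalence.trans eS s s' }
  }

record IsFilter {I : Set} (F : Partition I → Set) : Set₁ where
  field
    nonempty    : ∃ λ P → F P
    meet-closed : ∀ P Q → F P → F Q → F (P ⊓ Q)
    up-closed   : ∀ P Q → F P → P ⪯ Q → F Q

Π : {A I : Set} → (I → A) → Partition I
Π f = (λ i j → f i ≡ f j) , record
  { refl  = Relation.Binary.PropositionalEquality.refl
  ; sym   = Relation.Binary.PropositionalEquality.sym
  ; trans = Relation.Binary.PropositionalEquality.trans }
  where import Relation.Binary.PropositionalEquality

-- Let F consist of the partitions coarser than Π(g₁) ⊓ … ⊓ Π(gₙ) for finitely
-- many g₁, …, gₙ ∈ B; this is a filter, and it contains Π(f) for every f ∈ B.
-- Conversely, if Π(g₁) ⊓ … ⊓ Π(gₙ) refines Π(f), then f is constant on the fibres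
-- of i ↦ (g₁ i, …, gₙ i), so f = h(g₁, …, gₙ) for some h : Aⁿ → A, and f ∈ B
-- because B is closed under the basic operation ĥ. Working with tuples instead of
-- coding Aⁿ into A, infiniteness of A is only used to make A, hence F, nonempty.
module Submission where

open import Defs
open import Axiom.ExcludedMiddle using (ExcludedMiddle)
open import Axiom.Extensionality.Propositional using (Extensionality)
open import Level using (0ℓ)
open import Data.Nat using (ℕ; suc; _+_)
open import Data.Fin using (zero; splitAt)
open import Data.Sum using (inj₁; inj₂)
open import Data.Product using (Σ; ∃; _×_; _,_)
open import Data.Vec.Functional using (Vector; _++_)
open import Data.Vec.Functional.Properties using (++-injectiveˡ; ++-injectiveʳ)
open import Data.Empty using (⊥-elim)
open import Function.Base using (_∘_)
open import Function.Bundles using (_⇔_; mk⇔; mk↔ₛ′)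
open import Relation.Nullary using (yes; no)
open import Relation.Nullary.Decidable using (decidable-stable)
open import Relation.Binary.PropositionalEquality using (_≡_; refl; sym; cong-app; subst)

inhabited : ExcludedMiddle 0ℓ → {A : Set} → Infinite A → A
inhabited lem inf = decidable-stable lem λ ¬a →
  inf 0 (mk↔ₛ′ (⊥-elim ∘ ¬a) (λ ()) (λ ()) (⊥-elim ∘ ¬a))

factor-through : ExcludedMiddle 0ℓ → {I C D : Set} →
  (g : I → C) (f : I → D) → (C → D) → Π g ⪯ Π f →
  Σ (C → D) λ h → ∀ i → f i ≡ h (g i)
factor-through lem {C = C} {D} g f default Πg⪯Πf = h , f≡h∘g
  where
  h : C → D
  h c with lem {∃ λ i → g i ≡ c}
  ... | yes (i , _) = f i
  ... | no _        = default c

  f≡h∘g : ∀ i → f i ≡ h (g i)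
  f≡h∘g i with lem {∃ λ j → g j ≡ g i}
  ... | yes (j , gj≡gi) = sym (Πg⪯Πf gj≡gi)
  ... | no ∄j           = ⊥-elim (∄j (i , refl))

module _ {A I : Set} where

  Π-++-⪯ : Extensionality 0ℓ 0ℓ → ∀ {m n} (g : I → Vector A m) (h : I → Vector A n) →
           Π (λ i → g i ++ h i) ⪯ (Π g ⊓ Π h)
  Π-++-⪯ ext g h {i} {j} e =
    ext (++-injectiveˡ (g i) (g j) (cong-app e)) ,
    ext (++-injectiveʳ (g i) (g j) (cong-app e))

-- A map g : I → Aⁿ stands for the n-tuple of its coordinate functions, and
-- Π g for the meet of their partitions.
module _ {A I : Set} (B : (I → A) → Set) where

  AllIn : {n : ℕ} → (I → Vector A n) → Set
  AllIn g = ∀ k → B (λ i → g i k)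

  AllIn-++ : ∀ {m n} {g : I → Vector A m} {h : I → Vector A n} →
             AllIn g → AllIn h → AllIn (λ i → g i ++ h i)
  AllIn-++ {m} gs∈B hs∈B k with splitAt m k
  ... | inj₁ k′ = gs∈B k′
  ... | inj₂ k′ = hs∈B k′

  -- Tuples are nonempty since B is only closed under operations of arity ≥ 1.
  KernelFilter : Partition I → Set
  KernelFilter P = Σ ℕ λ n → Σ (I → Vector A (suc n)) λ g → AllIn g × Π g ⪯ P

  Π∈KernelFilter : {f : I → A} → B f → KernelFilter (Π f)
  Π∈KernelFilter {f} f∈B = 0 , (λ i _ → f i) , (λ _ → f∈B) , (λ e → cong-app e zero)

  KernelFilter-isFilter : Extensionality 0ℓ 0ℓ → ∃ B → IsFilter KernelFilter
  KernelFilter-isFilter ext (f , f∈B) = record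
    { nonempty    = Π f , Π∈KernelFilter f∈B
    ; meet-closed = λ { P Q (m , g , gs∈B , Πg⪯P) (n , h , hs∈B , Πh⪯Q) →
        m + suc n , (λ i → g i ++ h i) , AllIn-++ gs∈B hs∈B ,
        λ e → let Πg , Πh = Π-++-⪯ ext g h e in Πg⪯P Πg , Πh⪯Q Πh }
    ; up-closed   = λ { P Q (n , g , gs∈B , Πg⪯P) P⪯Q → n , g , gs∈B , P⪯Q ∘ Πg⪯P }
    }

  KernelFilter-closed : ExcludedMiddle 0ℓ → Extensionality 0ℓ 0ℓ →
    IsSubalgebra A I B → {f : I → A} → KernelFilter (Π f) → B f
  KernelFilter-closed lem ext sub {f} (n , g , gs∈B , Πg⪯Πf)
    with factor-through lem g f (λ v → v zero) Πg⪯Πf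
  ... | h , f≡h∘g =
    subst B (sym (ext f≡h∘g)) (IsSubalgebra.op-closed sub n h (λ k i → g i k) gs∈B)

mainTheorem1 : ExcludedMiddle 0ℓ → Extensionality 0ℓ 0ℓ →
    (A I : Set) → Infinite A →
    (B : (I → A) → Set) → IsSubalgebra A I B →
    Σ (Partition I → Set) λ F → IsFilter F ×
      ((f : I → A) → (B f ⇔ F (Π f)))
mainTheorem1 lem ext A I inf B sub =
  KernelFilter B ,
  KernelFilter-isFilter B ext (_ , IsSubalgebra.const-closed sub (inhabited lem inf)) ,
  λ f → mk⇔ (Π∈KernelFilter B) (KernelFilter-closed B lem ext sub)
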